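{- Let $G$ be a finite simple triangle-free cubic totally silver graph which contains a $4$--cycle, with $|V(G)|>4$. Then $G$ can be reduced to a cubic totally silver graph on $|V(G)|-4$ vertices; that is, there is a cubic totally silver graph $G'$ obtained from $G$ by deleting four vertices together with their incident edges and adding some new edges between remaining vertices.
   Context: A totally silver coloring of a graph $G$ is a map $c$ from $V(G)$ to a set of colors such that for every $v\in V(G)$, each color appears exactly once on the closed neighborhood $N[v]$; a graph is totally silver if it admits one. Cubic means $3$--regular. -}

module Defs where

open import Data.Nat using (ℕ; zero; suc)
open import Data.Bool using (Bool; true; false; if_then_else_; _∨_; _∧_)
open import Data.Fin using (Fin)
open import Data.Fin.Properties using (_≟_)
open import Data.List using (List; map; allFin)
open import Data.Nat.ListAction using (sum)
open import Data.Product using (Σ; ∃; ∃-syntax; _×_; _,_)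
open import Relation.Nullary using (¬_)
open import Relation.Nullary.Decidable using (⌊_⌋)
open import Relation.Binary.PropositionalEquality using (_≡_; _≢_)

record Graph (n : ℕ) : Set where
  field
    adj    : Fin n → Fin n → Bool
    sym    : ∀ u v → adj u v ≡ adj v u
    irrefl : ∀ v → adj v v ≡ false
open Graph public

countV : {n : ℕ} → (Fin n → Bool) → ℕ
countV {n} p = sum (map (λ u → if p u then 1 else 0) (allFin n))

degree : {n : ℕ} → Graph n → Fin n → ℕ
degree G v = countV (λ u → adj G v u)

Cubic : {n : ℕ} → Graph n → Set
Cubic G = ∀ v → degree G v ≡ 3

inClosedNbhd : {n : ℕ} → Graph n → Fin n → Fin n → Bool
inClosedNbhd G v u = ⌊ u ≟ v ⌋ ∨ adj G v u

TotallySilverColoring : {n k : ℕ} → Graph n → (Fin n → Fin k) → Set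
TotallySilverColoring {n} {k} G c =
  ∀ (v : Fin n) (i : Fin k) →
    countV (λ u → inClosedNbhd G v u ∧ ⌊ c u ≟ i ⌋) ≡ 1

TotallySilver : {n : ℕ} → Graph n → Set
TotallySilver {n} G = ∃[ k ] Σ (Fin n → Fin k) (λ c → TotallySilverColoring G c)

TriangleFree : {n : ℕ} → Graph n → Set
TriangleFree G = ∀ u v w →
  ¬ (adj G u v ≡ true × adj G v w ≡ true × adj G w u ≡ true)

HasFourCycle : {n : ℕ} → Graph n → Set
HasFourCycle G = ∃[ a ] ∃[ b ] ∃[ c ] ∃[ d ]
  ( a ≢ b × a ≢ c × a ≢ d × b ≢ c × b ≢ d × c ≢ d
  × adj G a b ≡ true × adj G b c ≡ true × adj G c d ≡ true × adj G d a ≡ true )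

module Submission where

-- Let a-b-c-d-a be a 4-cycle of G and let A, B, C, D be the neighbours of
-- a, b, c, d off the cycle (the "pendants").  In a totally silver colouring
-- the closed neighbourhood of a vertex sees every colour exactly once; this
-- forces col A = col c, col B = col d, col C = col a, col D = col b, so the
-- pendants are pairwise distinct, lie off the cycle, A ≁ C and B ≁ D.
-- Delete a, b, c, d and add the edges AC and BD.  A vertex other than the
-- pendants keeps its neighbourhood; the pendant A exchanges its neighbour a
-- for C, which has the same colour (and symmetrically for B, C, D).  Hence
-- every surviving vertex keeps its degree and the colours of its
-- neighbourhood, so the reduced graph is cubic and the colouring restricts.

open import Defs hiding (sym)
open import Data.Nat using (ℕ; zero; suc; _+_; _<_; _∸_; s≤s)
open import Data.Nat.Properties using (suc-injective; +-commutativeSemigroup)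
open import Algebra.Properties.CommutativeSemigroup +-commutativeSemigroup using (x∙yz≈y∙xz)
open import Data.Bool using (Bool; true; false; not; _∧_; _∨_; if_then_else_)
open import Data.Bool.Properties
  using (∧-assoc; ∧-comm; ∧-zeroʳ; ∧-identityʳ; ∨-comm; ∨-zeroʳ; ∨-identityʳ; ¬-not; not-¬)
open import Data.Fin using (Fin; zero; suc; punchIn; punchOut)
open import Data.Fin.Properties
  using (_≟_; punchIn-injective; punchInᵢ≢i; punchIn-punchOut; punchOut-injective)
open import Data.List using (map; tabulate)
open import Data.Nat.ListAction using (sum)
open import Data.Product using (Σ; ∃-syntax; _×_; _,_; proj₁; proj₂)
open import Data.Sum using (_⊎_; inj₁; inj₂; [_,_])
open import Data.Empty using (⊥; ⊥-elim)
open import Function using (_∘_)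
open import Function.Definitions using (Injective)
open import Relation.Nullary using (Dec; yes; no)
open import Relation.Nullary.Decidable using (⌊_⌋)
open import Relation.Binary.PropositionalEquality
  using (_≡_; _≢_; refl; sym; trans; cong; cong₂; subst; ≢-sym; module ≡-Reasoning)
open ≡-Reasoning

≟-refl : ∀ {n} (x : Fin n) → ⌊ x ≟ x ⌋ ≡ true
≟-refl x with x ≟ x
... | yes _ = refl
... | no x≢x = ⊥-elim (x≢x refl)

≟-≢ : ∀ {n} {x y : Fin n} → x ≢ y → ⌊ x ≟ y ⌋ ≡ false
≟-≢ {x = x} {y} x≢y with x ≟ y
... | yes x≡y = ⊥-elim (x≢y x≡y)
... | no _ = refl

≟-sound : ∀ {n} {x y : Fin n} → ⌊ x ≟ y ⌋ ≡ true → x ≡ y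
≟-sound {x = x} {y} h with x ≟ y
... | yes x≡y = x≡y
≟-sound {x = x} {y} () | no _

∧-elim : ∀ {x y} → x ∧ y ≡ true → x ≡ true × y ≡ true
∧-elim {true} {true} _ = refl , refl

guarded : ∀ {b c} → (b ≡ true → c ≡ true) → c ∧ b ≡ b
guarded {true} b⇒c rewrite b⇒c refl = refl
guarded {false} _ = ∧-zeroʳ _

b2n : Bool → ℕ
b2n b = if b then 1 else 0

cnt : ∀ {n} → (Fin n → Bool) → ℕ
cnt {zero} p = 0
cnt {suc n} p = b2n (p zero) + cnt (λ j → p (suc j))

count-tabulate : ∀ {n} {A : Set} (f : Fin n → A) (p : A → Bool) →
  sum (map (λ u → b2n (p u)) (tabulate f)) ≡ cnt (λ j → p (f j))
count-tabulate {zero} f p = refl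
count-tabulate {suc n} f p = cong (b2n (p (f zero)) +_) (count-tabulate (λ j → f (suc j)) p)

countV≡cnt : ∀ {n} (p : Fin n → Bool) → countV p ≡ cnt p
countV≡cnt p = count-tabulate (λ j → j) p

cnt-ext : ∀ {n} {p q : Fin n → Bool} → (∀ y → p y ≡ q y) → cnt p ≡ cnt q
cnt-ext {zero} _ = refl
cnt-ext {suc n} p≗q = cong₂ _+_ (cong b2n (p≗q zero)) (cnt-ext (λ j → p≗q (suc j)))

cnt-punchIn : ∀ {n} (p : Fin (suc n) → Bool) x →
  cnt p ≡ b2n (p x) + cnt (λ j → p (punchIn x j))
cnt-punchIn p zero = refl
cnt-punchIn {suc n} p (suc x) =
  trans (cong (b2n (p zero) +_) (cnt-punchIn (λ j → p (suc j)) x)) (x∙yz≈y∙xz (b2n (p zero)) (b2n (p (suc x))) _)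

cnt-drop : ∀ {n} (p : Fin (suc n) → Bool) x → p x ≡ false →
  cnt p ≡ cnt (λ j → p (punchIn x j))
cnt-drop p x px = trans (cnt-punchIn p x) (cong (λ t → b2n t + cnt (λ j → p (punchIn x j))) px)

remove : ∀ {n} → Fin n → (Fin n → Bool) → Fin n → Bool
remove y p w = p w ∧ not ⌊ w ≟ y ⌋

remove-intro : ∀ {n} {p : Fin n → Bool} {w y} → p w ≡ true → w ≢ y → remove y p w ≡ true
remove-intro {w = w} {y} pw w≢y rewrite pw | ≟-≢ w≢y = refl

remove-elim : ∀ {n} {p : Fin n → Bool} {w y} → remove y p w ≡ true → p w ≡ true × w ≢ y
remove-elim {p = p} {w} {y} h with p w | w ≟ y
... | true | no w≢y = refl , w≢y
remove-elim () | true | yes _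
remove-elim () | false | _

cnt-split : ∀ {n} (p : Fin n → Bool) y → cnt p ≡ b2n (p y) + cnt (remove y p)
cnt-split {zero} p ()
cnt-split {suc n} p y = begin
  cnt p                                    ≡⟨ cnt-punchIn p y ⟩
  b2n (p y) + cnt (λ j → p (punchIn y j))  ≡⟨ cong (b2n (p y) +_) (sym rest) ⟩
  b2n (p y) + cnt (remove y p)             ∎
  where
  gone : remove y p y ≡ false
  gone rewrite ≟-refl y = ∧-zeroʳ (p y)
  unchanged : ∀ j → remove y p (punchIn y j) ≡ p (punchIn y j)
  unchanged j rewrite ≟-≢ (punchInᵢ≢i y j) = ∧-identityʳ _
  rest : cnt (remove y p) ≡ cnt (λ j → p (punchIn y j))
  rest = trans (cnt-drop (remove y p) y gone) (cnt-ext unchanged)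

cnt-member : ∀ {n} (p : Fin n → Bool) y → p y ≡ true → cnt p ≡ suc (cnt (remove y p))
cnt-member p y py = trans (cnt-split p y) (cong (λ t → b2n t + cnt (remove y p)) py)

cnt-absent : ∀ {n} (p : Fin n → Bool) {y} → cnt p ≡ 0 → p y ≡ true → ⊥
cnt-absent p {y} none py with trans (sym none) (cnt-member p y py)
... | ()

cnt-witness : ∀ {n} (p : Fin n → Bool) {k} → cnt p ≡ suc k → Σ (Fin n) (λ y → p y ≡ true)
cnt-witness {zero} p ()
cnt-witness {suc n} p h with p zero in p0
... | true = zero , p0
... | false with cnt-witness (λ j → p (suc j)) h
...   | y , py = suc y , py

cnt-unique : ∀ {n} (p : Fin n → Bool) {y z} → cnt p ≡ 1 → p y ≡ true → p z ≡ true → y ≡ z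
cnt-unique p {y} {z} one py pz with y ≟ z
... | yes y≡z = y≡z
... | no y≢z = ⊥-elim (cnt-absent (remove y p) others-none (remove-intro {p = p} pz (≢-sym y≢z)))
  where
  others-none : cnt (remove y p) ≡ 0
  others-none = suc-injective (trans (sym (cnt-member p y py)) one)

cnt-exchange : ∀ {n} {p q : Fin n → Bool} {r z} → r ≢ z → p r ≡ q z → p z ≡ false →
  q r ≡ false → (∀ y → y ≢ r → y ≢ z → p y ≡ q y) → cnt p ≡ cnt q
cnt-exchange {p = p} {q} {r} {z} r≢z pr≡qz pz qr agree = begin
  cnt p                         ≡⟨ cnt-split p r ⟩
  b2n (p r) + cnt (remove r p)  ≡⟨ cong₂ _+_ (cong b2n pr≡qz) (cnt-ext same-rest) ⟩
  b2n (q z) + cnt (remove z q)  ≡⟨ sym (cnt-split q z) ⟩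
  cnt q                         ∎
  where
  same-rest : ∀ y → p y ∧ not ⌊ y ≟ r ⌋ ≡ q y ∧ not ⌊ y ≟ z ⌋
  same-rest y with y ≟ r | y ≟ z
  ... | yes y≡r | yes y≡z = ⊥-elim (r≢z (trans (sym y≡r) y≡z))
  ... | yes refl | no _ = trans (∧-zeroʳ (p y)) (sym (cong (_∧ true) qr))
  ... | no _ | yes refl = trans (cong (_∧ true) pz) (sym (∧-zeroʳ (q y)))
  ... | no y≢r | no y≢z = cong (_∧ true) (agree y y≢r y≢z)

cnt-closed : ∀ {n} (p g : Fin n → Bool) x → p x ≡ false →
  cnt (λ y → (⌊ y ≟ x ⌋ ∨ p y) ∧ g y) ≡ b2n (g x) + cnt (λ y → p y ∧ g y)
cnt-closed p g x px = trans (cnt-split _ x) (cong₂ _+_ at-x (cnt-ext off-x))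
  where
  at-x : b2n ((⌊ x ≟ x ⌋ ∨ p x) ∧ g x) ≡ b2n (g x)
  at-x rewrite ≟-refl x = refl
  off-x : ∀ y → ((⌊ y ≟ x ⌋ ∨ p y) ∧ g y) ∧ not ⌊ y ≟ x ⌋ ≡ p y ∧ g y
  off-x y with y ≟ x
  ... | yes refl rewrite px = ∧-zeroʳ (g y)
  ... | no _ = ∧-identityʳ _

-- Deleting four distinct vertices a, b, c, d from Fin (4 + m): the
-- surviving vertices are enumerated injectively by ι, and counting over
-- the survivors is counting over all vertices restricted to "kept".
module Deletion {m : ℕ} (a b c d : Fin (4 + m))
  (a≢b : a ≢ b) (a≢c : a ≢ c) (a≢d : a ≢ d) (b≢c : b ≢ c) (b≢d : b ≢ d) (c≢d : c ≢ d) where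

  kept : Fin (4 + m) → Bool
  kept y = not (⌊ y ≟ a ⌋ ∨ ⌊ y ≟ b ⌋ ∨ ⌊ y ≟ c ⌋ ∨ ⌊ y ≟ d ⌋)

  kept-intro : ∀ {y} → y ≢ a → y ≢ b → y ≢ c → y ≢ d → kept y ≡ true
  kept-intro y≢a y≢b y≢c y≢d rewrite ≟-≢ y≢a | ≟-≢ y≢b | ≟-≢ y≢c | ≟-≢ y≢d = refl

  kept-a : kept a ≡ false
  kept-a rewrite ≟-refl a = refl

  kept-b : kept b ≡ false
  kept-b rewrite ≟-≢ (≢-sym a≢b) | ≟-refl b = refl

  kept-c : kept c ≡ false
  kept-c rewrite ≟-≢ (≢-sym a≢c) | ≟-≢ (≢-sym b≢c) | ≟-refl c = refl

  kept-d : kept d ≡ false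
  kept-d rewrite ≟-≢ (≢-sym a≢d) | ≟-≢ (≢-sym b≢d) | ≟-≢ (≢-sym c≢d) | ≟-refl d = refl

  -- Names of the remaining deleted vertices after deleting a, then b, then c.
  b₁ c₁ d₁ : Fin (3 + m)
  b₁ = punchOut a≢b
  c₁ = punchOut a≢c
  d₁ = punchOut a≢d

  b₁≢c₁ : b₁ ≢ c₁
  b₁≢c₁ = b≢c ∘ punchOut-injective a≢b a≢c

  b₁≢d₁ : b₁ ≢ d₁
  b₁≢d₁ = b≢d ∘ punchOut-injective a≢b a≢d

  c₁≢d₁ : c₁ ≢ d₁
  c₁≢d₁ = c≢d ∘ punchOut-injective a≢c a≢d

  c₂ d₂ : Fin (2 + m)
  c₂ = punchOut b₁≢c₁
  d₂ = punchOut b₁≢d₁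

  c₂≢d₂ : c₂ ≢ d₂
  c₂≢d₂ = c₁≢d₁ ∘ punchOut-injective b₁≢c₁ b₁≢d₁

  d₃ : Fin (1 + m)
  d₃ = punchOut c₂≢d₂

  back-b : punchIn a b₁ ≡ b
  back-b = punchIn-punchOut a≢b

  back-c : punchIn a (punchIn b₁ c₂) ≡ c
  back-c = trans (cong (punchIn a) (punchIn-punchOut b₁≢c₁)) (punchIn-punchOut a≢c)

  back-d : punchIn a (punchIn b₁ (punchIn c₂ d₃)) ≡ d
  back-d = begin
    punchIn a (punchIn b₁ (punchIn c₂ d₃))  ≡⟨ cong (punchIn a ∘ punchIn b₁) (punchIn-punchOut c₂≢d₂) ⟩
    punchIn a (punchIn b₁ d₂)               ≡⟨ cong (punchIn a) (punchIn-punchOut b₁≢d₁) ⟩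
    punchIn a d₁                            ≡⟨ punchIn-punchOut a≢d ⟩
    d                                       ∎

  ι : Fin m → Fin (4 + m)
  ι u = punchIn a (punchIn b₁ (punchIn c₂ (punchIn d₃ u)))

  ι-injective : Injective _≡_ _≡_ ι
  ι-injective = punchIn-injective d₃ _ _ ∘ punchIn-injective c₂ _ _
              ∘ punchIn-injective b₁ _ _ ∘ punchIn-injective a _ _

  punchIn-≢ : ∀ {k} (x : Fin (suc k)) {i j} → i ≢ j → punchIn x i ≢ punchIn x j
  punchIn-≢ x i≢j = i≢j ∘ punchIn-injective x _ _

  ι≢a : ∀ u → ι u ≢ a
  ι≢a u = punchInᵢ≢i a _

  ι≢b : ∀ u → ι u ≢ b
  ι≢b u = subst (ι u ≢_) back-b (punchIn-≢ a (punchInᵢ≢i b₁ _))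

  ι≢c : ∀ u → ι u ≢ c
  ι≢c u = subst (ι u ≢_) back-c (punchIn-≢ a (punchIn-≢ b₁ (punchInᵢ≢i c₂ _)))

  ι≢d : ∀ u → ι u ≢ d
  ι≢d u = subst (ι u ≢_) back-d (punchIn-≢ a (punchIn-≢ b₁ (punchIn-≢ c₂ (punchInᵢ≢i d₃ _))))

  kept-ι : ∀ u → kept (ι u) ≡ true
  kept-ι u = kept-intro (ι≢a u) (ι≢b u) (ι≢c u) (ι≢d u)

  count-survivors : ∀ (f : Fin (4 + m) → Bool) → cnt (λ u → f (ι u)) ≡ cnt (λ y → kept y ∧ f y)
  count-survivors f = sym (begin
    cnt F                                                                ≡⟨ cnt-drop F a (gone a kept-a) ⟩
    cnt (λ j → F (punchIn a j))                                          ≡⟨ cnt-drop (λ j → F (punchIn a j)) b₁ (trans (cong F back-b) (gone b kept-b)) ⟩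
    cnt (λ j → F (punchIn a (punchIn b₁ j)))                             ≡⟨ cnt-drop (λ j → F (punchIn a (punchIn b₁ j))) c₂ (trans (cong F back-c) (gone c kept-c)) ⟩
    cnt (λ j → F (punchIn a (punchIn b₁ (punchIn c₂ j))))                ≡⟨ cnt-drop (λ j → F (punchIn a (punchIn b₁ (punchIn c₂ j)))) d₃ (trans (cong F back-d) (gone d kept-d)) ⟩
    cnt (λ u → F (ι u))                                                  ≡⟨ cnt-ext (λ u → cong (_∧ f (ι u)) (kept-ι u)) ⟩
    cnt (λ u → f (ι u))                                                  ∎)
    where
    F : Fin (4 + m) → Bool
    F y = kept y ∧ f y
    gone : ∀ y → kept y ≡ false → F y ≡ false
    gone y k rewrite k = refl

edge : ∀ {n} → Fin n → Fin n → Fin n → Fin n → Bool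
edge p q x y = (⌊ x ≟ p ⌋ ∧ ⌊ y ≟ q ⌋) ∨ (⌊ x ≟ q ⌋ ∧ ⌊ y ≟ p ⌋)

edge-sym : ∀ {n} (p q x y : Fin n) → edge p q x y ≡ edge p q y x
edge-sym p q x y =
  trans (cong₂ _∨_ (∧-comm ⌊ x ≟ p ⌋ _) (∧-comm ⌊ x ≟ q ⌋ _)) (∨-comm (⌊ y ≟ q ⌋ ∧ ⌊ x ≟ p ⌋) _)

edge-irrefl : ∀ {n} {p q : Fin n} → p ≢ q → ∀ x → edge p q x x ≡ false
edge-irrefl {p = p} {q} p≢q x with x ≟ p
... | yes refl rewrite ≟-≢ p≢q = refl
... | no _ = ∧-zeroʳ _

edge-from : ∀ {n} {p q : Fin n} → p ≢ q → ∀ y → edge p q p y ≡ ⌊ y ≟ q ⌋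
edge-from {p = p} p≢q y rewrite ≟-refl p | ≟-≢ p≢q = ∨-identityʳ _

edge-to : ∀ {n} {p q : Fin n} → p ≢ q → ∀ y → edge p q q y ≡ ⌊ y ≟ p ⌋
edge-to {p = p} {q} p≢q y rewrite ≟-≢ (≢-sym p≢q) | ≟-refl q = refl

edge-away : ∀ {n} {p q x : Fin n} → x ≢ p → x ≢ q → ∀ y → edge p q x y ≡ false
edge-away x≢p x≢q y rewrite ≟-≢ x≢p | ≟-≢ x≢q = refl

module Rewiring {n k : ℕ} (G : Graph n) (col : Fin n → Fin k)
  (kept : Fin n → Bool) (extra : Fin n → Fin n → Bool) where

  adj⁺ : Fin n → Fin n → Bool
  adj⁺ x y = adj G x y ∨ extra x y

  Respects : (Fin n → Bool) → Set
  Respects g = ∀ {u v} → col u ≡ col v → g u ≡ g v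

  SameProfile : Fin n → Set
  SameProfile x = ∀ g → Respects g →
    cnt (λ y → (kept y ∧ adj⁺ x y) ∧ g y) ≡ cnt (λ y → adj G x y ∧ g y)

  unchanged-profile : ∀ {x} → (∀ y → extra x y ≡ false) →
    (∀ {y} → adj G x y ≡ true → kept y ≡ true) → SameProfile x
  unchanged-profile {x} no-extra nbrs-kept g _ = cnt-ext (λ y → cong (_∧ g y) (same y))
    where
    same : ∀ y → kept y ∧ adj⁺ x y ≡ adj G x y
    same y = begin
      kept y ∧ (adj G x y ∨ extra x y)  ≡⟨ cong (λ t → kept y ∧ (adj G x y ∨ t)) (no-extra y) ⟩
      kept y ∧ (adj G x y ∨ false)      ≡⟨ cong (kept y ∧_) (∨-identityʳ _) ⟩
      kept y ∧ adj G x y                ≡⟨ guarded nbrs-kept ⟩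
      adj G x y                         ∎

  exchanged-profile : ∀ {x r z} → adj G x r ≡ true → kept r ≡ false →
    adj G x z ≡ false → kept z ≡ true → col r ≡ col z → (∀ y → extra x y ≡ ⌊ y ≟ z ⌋) →
    (∀ {y} → adj G x y ≡ true → y ≢ r → kept y ≡ true) → SameProfile x
  exchanged-profile {x} {r} {z} x~r r-gone x≁z z-kept same-colour extra-is others-kept g respects =
    sym (cnt-exchange {p = λ y → adj G x y ∧ g y} {q = λ y → (kept y ∧ adj⁺ x y) ∧ g y}
      r≢z old-r≡new-z (cong (_∧ g z) x≁z) (cong (λ t → (t ∧ adj⁺ x r) ∧ g r) r-gone) agree)
    where
    r≢z : r ≢ z
    r≢z r≡z = not-¬ r-gone (trans (cong kept r≡z) z-kept)
    new-z : (kept z ∧ adj⁺ x z) ∧ g z ≡ g z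
    new-z rewrite z-kept | x≁z | extra-is z | ≟-refl z = refl
    old-r≡new-z : adj G x r ∧ g r ≡ (kept z ∧ adj⁺ x z) ∧ g z
    old-r≡new-z = trans (cong (_∧ g r) x~r) (trans (respects same-colour) (sym new-z))
    adj⁺-elsewhere : ∀ {y} → y ≢ z → adj⁺ x y ≡ adj G x y
    adj⁺-elsewhere {y} y≢z = trans (cong (adj G x y ∨_) (trans (extra-is y) (≟-≢ y≢z))) (∨-identityʳ _)
    agree : ∀ y → y ≢ r → y ≢ z → adj G x y ∧ g y ≡ (kept y ∧ adj⁺ x y) ∧ g y
    agree y y≢r y≢z = cong (_∧ g y) (sym (trans (cong (kept y ∧_) (adj⁺-elsewhere y≢z))
                                                (guarded (λ x~y → others-kept x~y y≢r))))

record Square {n : ℕ} (G : Graph n) : Set where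
  field
    a b c d : Fin n
    a≢b : a ≢ b
    a≢c : a ≢ c
    a≢d : a ≢ d
    b≢c : b ≢ c
    b≢d : b ≢ d
    c≢d : c ≢ d
    a~b : adj G a b ≡ true
    b~c : adj G b c ≡ true
    c~d : adj G c d ≡ true
    d~a : adj G d a ≡ true

rotate : ∀ {n} {G : Graph n} → Square G → Square G
rotate Q = record
  { a = b ; b = c ; c = d ; d = a
  ; a≢b = b≢c ; a≢c = b≢d ; a≢d = ≢-sym a≢b ; b≢c = c≢d ; b≢d = ≢-sym a≢c ; c≢d = ≢-sym a≢d
  ; a~b = b~c ; b~c = c~d ; c~d = d~a ; d~a = a~b }
  where open Square Q

module Local {n k : ℕ} (G : Graph n) (triangle-free : TriangleFree G) (cubic : Cubic G)
  (col : Fin n → Fin k) (silver : TotallySilverColoring G col) where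

  degree-three : ∀ v → cnt (adj G v) ≡ 3
  degree-three v = trans (sym (countV≡cnt (adj G v))) (cubic v)

  colour-once : ∀ v i → cnt (λ u → inClosedNbhd G v u ∧ ⌊ col u ≟ i ⌋) ≡ 1
  colour-once v i = trans (sym (countV≡cnt (λ u → inClosedNbhd G v u ∧ ⌊ col u ≟ i ⌋))) (silver v i)

  adj-sym : ∀ {u v} → adj G u v ≡ true → adj G v u ≡ true
  adj-sym {u} {v} h = trans (Graph.sym G v u) h

  adj⇒≢ : ∀ {u v} → adj G u v ≡ true → u ≢ v
  adj⇒≢ {u} h refl = not-¬ (irrefl G u) h

  non-adj⇒≢ : ∀ {x v y} → adj G x v ≡ false → adj G x y ≡ true → y ≢ v
  non-adj⇒≢ x≁v x~y refl = not-¬ x≁v x~y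

  colour-separates : ∀ {x y u v} → col x ≡ col u → col y ≡ col v → col u ≢ col v → x ≢ y
  colour-separates cx cy u≢v refl = u≢v (trans (sym cx) cy)

  in-closed-self : ∀ v → inClosedNbhd G v v ≡ true
  in-closed-self v rewrite ≟-refl v = refl

  in-closed-adj : ∀ {v u} → adj G v u ≡ true → inClosedNbhd G v u ≡ true
  in-closed-adj {v} {u} h rewrite h = ∨-zeroʳ _

  closed-colours-distinct : ∀ {v u w} → inClosedNbhd G v u ≡ true → inClosedNbhd G v w ≡ true →
    u ≢ w → col u ≢ col w
  closed-colours-distinct {v} {u} {w} hu hw u≢w same =
    u≢w (cnt-unique _ (colour-once v (col u)) has-u has-w)
    where
    has-u : inClosedNbhd G v u ∧ ⌊ col u ≟ col u ⌋ ≡ true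
    has-u rewrite hu | ≟-refl (col u) = refl
    has-w : inClosedNbhd G v w ∧ ⌊ col w ≟ col u ⌋ ≡ true
    has-w rewrite hw | same | ≟-refl (col w) = refl

  adjacent-colours : ∀ {u v} → adj G u v ≡ true → col u ≢ col v
  adjacent-colours {u} h = closed-colours-distinct (in-closed-self u) (in-closed-adj h) (adj⇒≢ h)

  common-neighbour-colours : ∀ {v u w} → adj G v u ≡ true → adj G v w ≡ true → u ≢ w → col u ≢ col w
  common-neighbour-colours hu hw = closed-colours-distinct (in-closed-adj hu) (in-closed-adj hw)

  colour-present : ∀ v i → Σ (Fin n) (λ u → (u ≡ v ⊎ adj G v u ≡ true) × col u ≡ i)
  colour-present v i with cnt-witness _ (colour-once v i)
  ... | u , h with ∧-elim {inClosedNbhd G v u} h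
  ...   | in-nbhd , has-colour = u , closed-cases in-nbhd , ≟-sound has-colour
    where
    closed-cases : inClosedNbhd G v u ≡ true → u ≡ v ⊎ adj G v u ≡ true
    closed-cases h with u ≟ v
    ... | yes u≡v = inj₁ u≡v
    ... | no _ = inj₂ h

  one-more-neighbour : ∀ {v y₁ y₂} → adj G v y₁ ≡ true → adj G v y₂ ≡ true → y₁ ≢ y₂ →
    cnt (remove y₂ (remove y₁ (adj G v))) ≡ 1
  one-more-neighbour {v} {y₁} {y₂} h₁ h₂ y₁≢y₂ = suc-injective (suc-injective (begin
    suc (suc (cnt (remove y₂ (remove y₁ (adj G v)))))
      ≡⟨ cong suc (sym (cnt-member _ y₂ (remove-intro {p = adj G v} h₂ (≢-sym y₁≢y₂)))) ⟩
    suc (cnt (remove y₁ (adj G v)))  ≡⟨ sym (cnt-member _ y₁ h₁) ⟩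
    cnt (adj G v)                    ≡⟨ degree-three v ⟩
    3                                ∎))

  third-neighbour : ∀ {v y₁ y₂} → adj G v y₁ ≡ true → adj G v y₂ ≡ true → y₁ ≢ y₂ →
    Σ (Fin n) (λ z → adj G v z ≡ true × z ≢ y₁ × z ≢ y₂)
  third-neighbour h₁ h₂ y₁≢y₂ with cnt-witness _ (one-more-neighbour h₁ h₂ y₁≢y₂)
  ... | z , h with remove-elim {p = remove _ (adj G _)} h
  ...   | h′ , z≢y₂ with remove-elim {p = adj G _} h′
  ...     | v~z , z≢y₁ = z , v~z , z≢y₁ , z≢y₂

  neighbours-exhausted : ∀ {v y₁ y₂ y₃ w} → adj G v y₁ ≡ true → adj G v y₂ ≡ true →
    adj G v y₃ ≡ true → y₁ ≢ y₂ → y₁ ≢ y₃ → y₂ ≢ y₃ → adj G v w ≡ true →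
    w ≡ y₁ ⊎ (w ≡ y₂ ⊎ w ≡ y₃)
  neighbours-exhausted {v} {y₁} {y₂} {y₃} {w} h₁ h₂ h₃ y₁≢y₂ y₁≢y₃ y₂≢y₃ hw with w ≟ y₁ | w ≟ y₂
  ... | yes w≡y₁ | _ = inj₁ w≡y₁
  ... | no _ | yes w≡y₂ = inj₂ (inj₁ w≡y₂)
  ... | no w≢y₁ | no w≢y₂ = inj₂ (inj₂
        (cnt-unique _ (one-more-neighbour h₁ h₂ y₁≢y₂) (other hw w≢y₁ w≢y₂)
                      (other h₃ (≢-sym y₁≢y₃) (≢-sym y₂≢y₃))))
    where
    other : ∀ {u} → adj G v u ≡ true → u ≢ y₁ → u ≢ y₂ → remove y₂ (remove y₁ (adj G v)) u ≡ true
    other hu u≢y₁ u≢y₂ = remove-intro {p = remove y₁ (adj G v)} (remove-intro {p = adj G v} hu u≢y₁) u≢y₂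

  module Pendant (Q : Square G) where
    open Square Q

    -- Kept abstract: only the properties below matter, never the witness.
    abstract
      private
        spec : Σ (Fin n) (λ z → adj G a z ≡ true × z ≢ b × z ≢ d)
        spec = third-neighbour a~b (adj-sym d~a) b≢d

      pendant : Fin n
      pendant = proj₁ spec

      a~pendant : adj G a pendant ≡ true
      a~pendant = proj₁ (proj₂ spec)

      pendant≢b : pendant ≢ b
      pendant≢b = proj₁ (proj₂ (proj₂ spec))

      pendant≢d : pendant ≢ d
      pendant≢d = proj₂ (proj₂ (proj₂ spec))

    pendant≢a : pendant ≢ a
    pendant≢a = ≢-sym (adj⇒≢ a~pendant)

    pendant≢c : pendant ≢ c
    pendant≢c p≡c = triangle-free a b c (a~b , b~c , adj-sym (subst (λ t → adj G a t ≡ true) p≡c a~pendant))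

    neighbours-of-a : ∀ {w} → adj G a w ≡ true → w ≡ b ⊎ (w ≡ d ⊎ w ≡ pendant)
    neighbours-of-a = neighbours-exhausted a~b (adj-sym d~a) a~pendant
                        b≢d (≢-sym pendant≢b) (≢-sym pendant≢d)

    non-neighbour : ∀ {x} → x ≢ b → x ≢ d → x ≢ pendant → adj G x a ≡ false
    non-neighbour x≢b x≢d x≢p = ¬-not (λ h → [ x≢b , [ x≢d , x≢p ] ] (neighbours-of-a (adj-sym h)))

    -- The colour of c must occur around a, and only the pendant can carry it.
    pendant-colour : col pendant ≡ col c
    pendant-colour with colour-present a (col c)
    ... | u , inj₁ refl , e = ⊥-elim (common-neighbour-colours (adj-sym a~b) b~c a≢c e)
    ... | u , inj₂ a~u , e with neighbours-of-a a~u
    ...   | inj₁ refl = ⊥-elim (adjacent-colours b~c e)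
    ...   | inj₂ (inj₁ refl) = ⊥-elim (adjacent-colours c~d (sym e))
    ...   | inj₂ (inj₂ refl) = e

  open Pendant public

  module PendantCross (Q : Square G) where
    open Square Q

    private
      Q₁ Q₂ Q₃ : Square G
      Q₁ = rotate Q
      Q₂ = rotate Q₁
      Q₃ = rotate Q₂

    -- Pendants carry the colours of distinct square vertices, hence differ.
    pendant≢next : pendant Q ≢ pendant Q₁
    pendant≢next = colour-separates (pendant-colour Q) (pendant-colour Q₁) (adjacent-colours c~d)

    pendant≢opposite : pendant Q ≢ pendant Q₂
    pendant≢opposite = colour-separates (pendant-colour Q) (pendant-colour Q₂)
                         (common-neighbour-colours b~c (adj-sym a~b) (≢-sym a≢c))

    pendant≢previous : pendant Q ≢ pendant Q₃
    pendant≢previous = colour-separates (pendant-colour Q) (pendant-colour Q₃) (adjacent-colours (adj-sym b~c))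

    pendant≁b : adj G (pendant Q) b ≡ false
    pendant≁b = non-neighbour Q₁ (pendant≢c Q) (pendant≢a Q) pendant≢next

    pendant≁c : adj G (pendant Q) c ≡ false
    pendant≁c = non-neighbour Q₂ (pendant≢d Q) (pendant≢b Q) pendant≢opposite

    pendant≁d : adj G (pendant Q) d ≡ false
    pendant≁d = non-neighbour Q₃ (pendant≢a Q) (pendant≢c Q) pendant≢previous

    -- The opposite pendant has the colour of a, a neighbour of this pendant.
    pendant≁opposite : adj G (pendant Q) (pendant Q₂) ≡ false
    pendant≁opposite = ¬-not (λ h → common-neighbour-colours (adj-sym (a~pendant Q)) h
                                      (≢-sym (pendant≢c Q₂)) (sym (pendant-colour Q₂)))

  open PendantCross public

module Reduction {m k : ℕ} (G : Graph (4 + m)) (triangle-free : TriangleFree G) (cubic : Cubic G)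
  (col : Fin (4 + m) → Fin k) (silver : TotallySilverColoring G col) (Q : Square G) where

  open Square Q
  open Local G triangle-free cubic col silver
  open Deletion a b c d a≢b a≢c a≢d b≢c b≢d c≢d public

  Q₁ Q₂ Q₃ : Square G
  Q₁ = rotate Q
  Q₂ = rotate Q₁
  Q₃ = rotate Q₂

  A B C D : Fin (4 + m)
  A = pendant Q
  B = pendant Q₁
  C = pendant Q₂
  D = pendant Q₃

  A≢B : A ≢ B
  A≢B = pendant≢next Q

  A≢C : A ≢ C
  A≢C = pendant≢opposite Q

  A≢D : A ≢ D
  A≢D = pendant≢previous Q

  B≢C : B ≢ C
  B≢C = pendant≢next Q₁

  B≢D : B ≢ D
  B≢D = pendant≢opposite Q₁

  C≢D : C ≢ D
  C≢D = pendant≢next Q₂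

  newEdges : Fin (4 + m) → Fin (4 + m) → Bool
  newEdges x y = edge A C x y ∨ edge B D x y

  open Rewiring G col kept newEdges

  newEdges-at-A : ∀ y → newEdges A y ≡ ⌊ y ≟ C ⌋
  newEdges-at-A y = trans (cong₂ _∨_ (edge-from A≢C y) (edge-away A≢B A≢D y)) (∨-identityʳ _)

  newEdges-at-B : ∀ y → newEdges B y ≡ ⌊ y ≟ D ⌋
  newEdges-at-B y = cong₂ _∨_ (edge-away (≢-sym A≢B) B≢C y) (edge-from B≢D y)

  newEdges-at-C : ∀ y → newEdges C y ≡ ⌊ y ≟ A ⌋
  newEdges-at-C y = trans (cong₂ _∨_ (edge-to A≢C y) (edge-away (≢-sym B≢C) C≢D y)) (∨-identityʳ _)

  newEdges-at-D : ∀ y → newEdges D y ≡ ⌊ y ≟ B ⌋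
  newEdges-at-D y = cong₂ _∨_ (edge-away (≢-sym A≢D) (≢-sym C≢D) y) (edge-to B≢D y)

  newEdges-elsewhere : ∀ {x} → x ≢ A → x ≢ B → x ≢ C → x ≢ D → ∀ y → newEdges x y ≡ false
  newEdges-elsewhere x≢A x≢B x≢C x≢D y = cong₂ _∨_ (edge-away x≢A x≢C y) (edge-away x≢B x≢D y)

  kept-A : kept A ≡ true
  kept-A = kept-intro (pendant≢a Q) (pendant≢b Q) (pendant≢c Q) (pendant≢d Q)

  kept-B : kept B ≡ true
  kept-B = kept-intro (pendant≢d Q₁) (pendant≢a Q₁) (pendant≢b Q₁) (pendant≢c Q₁)

  kept-C : kept C ≡ true
  kept-C = kept-intro (pendant≢c Q₂) (pendant≢d Q₂) (pendant≢a Q₂) (pendant≢b Q₂)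

  kept-D : kept D ≡ true
  kept-D = kept-intro (pendant≢b Q₃) (pendant≢c Q₃) (pendant≢d Q₃) (pendant≢a Q₃)

  -- Each pendant trades its square neighbour for the opposite pendant.
  profile-A : SameProfile A
  profile-A = exchanged-profile (adj-sym (a~pendant Q)) kept-a (pendant≁opposite Q) kept-C
    (sym (pendant-colour Q₂)) newEdges-at-A
    (λ h y≢a → kept-intro y≢a (non-adj⇒≢ (pendant≁b Q) h) (non-adj⇒≢ (pendant≁c Q) h) (non-adj⇒≢ (pendant≁d Q) h))

  profile-B : SameProfile B
  profile-B = exchanged-profile (adj-sym (a~pendant Q₁)) kept-b (pendant≁opposite Q₁) kept-D
    (sym (pendant-colour Q₃)) newEdges-at-B
    (λ h y≢b → kept-intro (non-adj⇒≢ (pendant≁d Q₁) h) y≢b (non-adj⇒≢ (pendant≁b Q₁) h) (non-adj⇒≢ (pendant≁c Q₁) h))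

  profile-C : SameProfile C
  profile-C = exchanged-profile (adj-sym (a~pendant Q₂)) kept-c
    (trans (Graph.sym G C A) (pendant≁opposite Q)) kept-A (sym (pendant-colour Q)) newEdges-at-C
    (λ h y≢c → kept-intro (non-adj⇒≢ (pendant≁c Q₂) h) (non-adj⇒≢ (pendant≁d Q₂) h) y≢c (non-adj⇒≢ (pendant≁b Q₂) h))

  profile-D : SameProfile D
  profile-D = exchanged-profile (adj-sym (a~pendant Q₃)) kept-d
    (trans (Graph.sym G D B) (pendant≁opposite Q₁)) kept-B (sym (pendant-colour Q₁)) newEdges-at-D
    (λ h y≢d → kept-intro (non-adj⇒≢ (pendant≁b Q₃) h) (non-adj⇒≢ (pendant≁c Q₃) h) (non-adj⇒≢ (pendant≁d Q₃) h) y≢d)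

  -- A surviving vertex other than the pendants has no neighbour on the square.
  survivor-profile : ∀ {x} → x ≢ a → x ≢ b → x ≢ c → x ≢ d → SameProfile x
  survivor-profile {x} x≢a x≢b x≢c x≢d = by-cases (x ≟ A) (x ≟ B) (x ≟ C) (x ≟ D)
    where
    by-cases : Dec (x ≡ A) → Dec (x ≡ B) → Dec (x ≡ C) → Dec (x ≡ D) → SameProfile x
    by-cases (yes x≡A) _ _ _ = subst SameProfile (sym x≡A) profile-A
    by-cases _ (yes x≡B) _ _ = subst SameProfile (sym x≡B) profile-B
    by-cases _ _ (yes x≡C) _ = subst SameProfile (sym x≡C) profile-C
    by-cases _ _ _ (yes x≡D) = subst SameProfile (sym x≡D) profile-D
    by-cases (no x≢A) (no x≢B) (no x≢C) (no x≢D) =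
      unchanged-profile (newEdges-elsewhere x≢A x≢B x≢C x≢D) (λ h → kept-intro
        (non-adj⇒≢ (non-neighbour Q x≢b x≢d x≢A) h) (non-adj⇒≢ (non-neighbour Q₁ x≢c x≢a x≢B) h)
        (non-adj⇒≢ (non-neighbour Q₂ x≢d x≢b x≢C) h) (non-adj⇒≢ (non-neighbour Q₃ x≢a x≢c x≢D) h))

  ι-profile : ∀ u → SameProfile (ι u)
  ι-profile u = survivor-profile (ι≢a u) (ι≢b u) (ι≢c u) (ι≢d u)

  reduced : Graph m
  reduced = record
    { adj = λ u v → adj⁺ (ι u) (ι v)
    ; sym = λ u v → cong₂ _∨_ (Graph.sym G (ι u) (ι v))
                      (cong₂ _∨_ (edge-sym A C (ι u) (ι v)) (edge-sym B D (ι u) (ι v)))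
    ; irrefl = λ u → cong₂ _∨_ (irrefl G (ι u))
                       (cong₂ _∨_ (edge-irrefl A≢C (ι u)) (edge-irrefl B≢D (ι u))) }

  keeps-old-edges : ∀ u v → adj G (ι u) (ι v) ≡ true → adj reduced u v ≡ true
  keeps-old-edges u v h = cong (_∨ newEdges (ι u) (ι v)) h

  count-new-neighbours : ∀ u g → Respects g →
    cnt (λ w → adj reduced u w ∧ g (ι w)) ≡ cnt (λ y → adj G (ι u) y ∧ g y)
  count-new-neighbours u g respects = begin
    cnt (λ w → adj⁺ (ι u) (ι w) ∧ g (ι w))  ≡⟨ count-survivors (λ y → adj⁺ (ι u) y ∧ g y) ⟩
    cnt (λ y → kept y ∧ (adj⁺ (ι u) y ∧ g y)) ≡⟨ cnt-ext (λ y → sym (∧-assoc (kept y) (adj⁺ (ι u) y) (g y))) ⟩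
    cnt (λ y → (kept y ∧ adj⁺ (ι u) y) ∧ g y) ≡⟨ ι-profile u g respects ⟩
    cnt (λ y → adj G (ι u) y ∧ g y)           ∎

  reduced-cubic : Cubic reduced
  reduced-cubic u = begin
    countV (adj reduced u)                   ≡⟨ countV≡cnt (adj reduced u) ⟩
    cnt (adj reduced u)                      ≡⟨ cnt-ext (λ w → sym (∧-identityʳ (adj reduced u w))) ⟩
    cnt (λ w → adj reduced u w ∧ true)       ≡⟨ count-new-neighbours u (λ _ → true) (λ _ → refl) ⟩
    cnt (λ y → adj G (ι u) y ∧ true)         ≡⟨ cnt-ext (λ y → ∧-identityʳ (adj G (ι u) y)) ⟩
    cnt (adj G (ι u))                        ≡⟨ degree-three (ι u) ⟩
    3                                        ∎

  reduced-silver : TotallySilverColoring reduced (λ u → col (ι u))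
  reduced-silver u i = begin
    countV (λ w → inClosedNbhd reduced u w ∧ has-i (ι w))
      ≡⟨ countV≡cnt (λ w → inClosedNbhd reduced u w ∧ has-i (ι w)) ⟩
    cnt (λ w → inClosedNbhd reduced u w ∧ has-i (ι w))
      ≡⟨ cnt-closed (adj reduced u) (λ w → has-i (ι w)) u (irrefl reduced u) ⟩
    b2n (has-i (ι u)) + cnt (λ w → adj reduced u w ∧ has-i (ι w))
      ≡⟨ cong (b2n (has-i (ι u)) +_) (count-new-neighbours u has-i (cong (λ j → ⌊ j ≟ i ⌋))) ⟩
    b2n (has-i (ι u)) + cnt (λ y → adj G (ι u) y ∧ has-i y)
      ≡⟨ sym (cnt-closed (adj G (ι u)) has-i (ι u) (irrefl G (ι u))) ⟩
    cnt (λ y → inClosedNbhd G (ι u) y ∧ has-i y)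
      ≡⟨ colour-once (ι u) i ⟩
    1 ∎
    where
    has-i : Fin (4 + m) → Bool
    has-i y = ⌊ col y ≟ i ⌋

lemma3p3 : (n : ℕ) (G : Graph n) → TriangleFree G → Cubic G → TotallySilver G
    → HasFourCycle G → 4 < n
    → ∃[ G' ] Σ (Fin (n ∸ 4) → Fin n) (λ ι →
         Injective _≡_ _≡_ ι
         × (∀ u v → adj G (ι u) (ι v) ≡ true → adj G' u v ≡ true)
         × Cubic G' × TotallySilver G')
lemma3p3 (suc (suc (suc (suc m)))) G triangle-free cubic (k , col , silver)
  (a , b , c , d , a≢b , a≢c , a≢d , b≢c , b≢d , c≢d , a~b , b~c , c~d , d~a) _ =
  reduced , ι , ι-injective , keeps-old-edges , reduced-cubic , (k , (λ u → col (ι u)) , reduced-silver)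
  where
  square : Square G
  square = record { a = a ; b = b ; c = c ; d = d
                  ; a≢b = a≢b ; a≢c = a≢c ; a≢d = a≢d ; b≢c = b≢c ; b≢d = b≢d ; c≢d = c≢d
                  ; a~b = a~b ; b~c = b~c ; c~d = c~d ; d~a = d~a }
  open Reduction G triangle-free cubic col silver square
lemma3p3 zero _ _ _ _ _ ()
lemma3p3 (suc zero) _ _ _ _ _ (s≤s ())
lemma3p3 (suc (suc zero)) _ _ _ _ _ (s≤s (s≤s ()))
lemma3p3 (suc (suc (suc zero))) _ _ _ _ _ (s≤s (s≤s (s≤s ())))
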